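{- Let $G=(V,E)$ be a finite simple undirected graph, let $k\ge 0$ be an integer, let $lb$ be an integer, and let $c$ be a proper coloring of $G$. If $\theta(G,k)\ge lb$ and there is an edge $\{u,v\}\in E$ such that $|\{c(w): w\in N(u)\cap N(v)\}|\le \theta(G,k)-3$, then $\theta(G,k)=\theta((V,E\setminus\{\{u,v\}\}),k)$.
   Context: A (proper) coloring of $G$ is a map $c:V\to\mathbb{Z}$ with $c(x)\ne c(y)$ whenever $\{x,y\}\in E$. $N(x)=\{w:\{x,w\}\in E\}$. For $S\subseteq V$, $G[S]$ is the induced subgraph; $\omega(H)$ is the size of a largest clique in $H$; and $\theta(G,k)=\min_{S\subseteq V,\ |S|\le k}\omega(G[V\setminus S])$. -}

module Defs where

open import Data.Nat using (ℕ; _≤_)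
open import Data.Integer using (ℤ) renaming (_≟_ to _≟ℤ_)
open import Data.Bool using (Bool; true; false; _∧_; _∨_; not)
open import Data.Bool.Properties using (∧-comm; ∨-comm)
open import Data.Fin using (Fin; _≟_)
open import Data.Fin.Subset using (Subset; _∈_; _∉_; ∣_∣)
open import Data.List using (List; length; map; filter; deduplicate; allFin)
open import Data.Product using (Σ; _×_; _,_)
open import Relation.Nullary using (does)
open import Relation.Binary.PropositionalEquality
  using (_≡_; _≢_; refl; trans; cong; cong₂)

record Graph (n : ℕ) : Set where
  field
    adj    : Fin n → Fin n → Bool
    sym    : ∀ x y → adj x y ≡ adj y x
    irrefl : ∀ x → adj x x ≡ false
open Graph public

Edge : ∀ {n} → Graph n → Fin n → Fin n → Set
Edge G x y = adj G x y ≡ true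

ProperColoring : ∀ {n} → Graph n → (Fin n → ℤ) → Set
ProperColoring G c = ∀ x y → Edge G x y → c x ≢ c y

samePair : ∀ {n} → Fin n → Fin n → Fin n → Fin n → Bool
samePair u v x y = (does (x ≟ u) ∧ does (y ≟ v)) ∨ (does (x ≟ v) ∧ does (y ≟ u))

private
  samePair-sym : ∀ {n} (u v x y : Fin n) → samePair u v x y ≡ samePair u v y x
  samePair-sym u v x y = trans (∨-comm (does (x ≟ u) ∧ does (y ≟ v)) (does (x ≟ v) ∧ does (y ≟ u)))
    (cong₂ _∨_ (∧-comm (does (x ≟ v)) (does (y ≟ u))) (∧-comm (does (x ≟ u)) (does (y ≟ v))))

  ∧-false : ∀ {b} c → b ≡ false → (b ∧ c) ≡ false
  ∧-false c refl = refl

deleteEdge : ∀ {n} → Graph n → Fin n → Fin n → Graph n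
deleteEdge G u v = record
  { adj    = λ x y → adj G x y ∧ not (samePair u v x y)
  ; sym    = λ x y → cong₂ _∧_ (sym G x y) (cong not (samePair-sym u v x y))
  ; irrefl = λ x → ∧-false _ (irrefl G x) }

commonNbr : ∀ {n} → Graph n → Fin n → Fin n → Fin n → Bool
commonNbr G u v w = adj G u w ∧ adj G v w

numCommonColors : ∀ {n} → Graph n → (Fin n → ℤ) → Fin n → Fin n → ℕ
numCommonColors {n} G c u v =
  length (deduplicate _≟ℤ_ (map c (filter (λ w → commonNbr G u v w ≟b true) (allFin n))))
  where open import Data.Bool using () renaming (_≟_ to _≟b_)

-- C is a clique of the induced subgraph G[V ∖ S]
IsCliqueAvoiding : ∀ {n} → Graph n → Subset n → Subset n → Set
IsCliqueAvoiding G S C =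
  (∀ x → x ∈ C → x ∉ S) × (∀ x y → x ∈ C → y ∈ C → x ≢ y → Edge G x y)

IsOmega : ∀ {n} → Graph n → Subset n → ℕ → Set
IsOmega G S m =
  Σ _ (λ C → IsCliqueAvoiding G S C × ∣ C ∣ ≡ m)
  × (∀ C → IsCliqueAvoiding G S C → ∣ C ∣ ≤ m)

-- θ(G,k) = t : t = min over S ⊆ V with |S| ≤ k of ω(G[V ∖ S])
IsTheta : ∀ {n} → Graph n → ℕ → ℕ → Set
IsTheta G k t =
  Σ _ (λ S → ∣ S ∣ ≤ k × IsOmega G S t)
  × (∀ S m → ∣ S ∣ ≤ k → IsOmega G S m → t ≤ m)

-- A clique containing both ends of the edge {u,v} consists of u, v and common neighbours
-- of u and v; a proper colouring is injective on a clique, so such a clique has at most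
-- |c(N(u) ∩ N(v))| + 2 ≤ θ(G,k) − 1 vertices. Hence every clique of size at least θ(G,k)
-- avoids the pair {u,v} and survives the deletion of the edge, while deleting an edge
-- never creates cliques. So ω(G[V∖S]) ≥ θ(G,k) implies ω(G[V∖S] − uv) = ω(G[V∖S]), and θ
-- is unchanged.
module Submission where

open import Defs
open import Data.Nat using (ℕ; zero; suc; z≤n; s≤s; _≤_; _<_; _≤?_; _+_)
open import Data.Nat.Properties using (≤-refl; ≤-trans; ≤-antisym; ≤-reflexive; <⇒≱; ≤-pred; ≰⇒>; +-comm)
open import Data.Integer using (ℤ; +_) renaming (_≤_ to _≤ℤ_; _≟_ to _≟ℤ_)
open import Data.Bool using (true; T; _∧_) renaming (_≟_ to _≟b_)
open import Data.Bool.Properties using (T-≡; T-∨; ∧-conicalˡ; ¬-not)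
open import Data.Fin using (Fin) renaming (zero to fzero; suc to fsuc; _≟_ to _≟f_)
open import Data.Fin.Properties using (all?; suc-injective)
open import Data.Fin.Subset using (Subset; _∈_; ∣_∣; ⊥; inside; outside)
open import Data.Fin.Subset.Properties using (_∈?_; ∉⊥; ∣p∣≤n; anySubset?)
open import Data.Vec using ([]; _∷_; here; there)
open import Data.List using (List; _∷_; length; filter; allFin)
open import Data.List.Properties using (filter-notAll)
open import Data.List.Membership.Propositional using () renaming (_∈_ to _∈ˡ_)
open import Data.List.Membership.Propositional.Properties using (∈-map⁺; ∈-filter⁺; ∈-allFin; ∈-deduplicate⁺)
open import Data.List.Relation.Unary.Any as Any using () renaming (here to hereˡ; there to thereˡ)
open import Data.Product using (∃; _×_; _,_)
open import Data.Sum using (_⊎_; inj₁; inj₂)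
import Data.Sum as Sum
open import Function using (_∘_; Equivalence)
open import Relation.Nullary using (Dec; yes; no; ¬_; does; contradiction; ¬?; _×-dec_; _→-dec_)
open import Relation.Unary using (Pred; Decidable)
open import Relation.Binary.Definitions using (DecidableEquality)
open import Relation.Binary.PropositionalEquality using (_≡_; _≢_; refl; cong₂) renaming (sym to ≡-sym)

injectiveOn⇒∣p∣≤length : ∀ {n} {A : Set} → DecidableEquality A → (p : Subset n) (f : Fin n → A) (xs : List A) →
  (∀ {i j} → i ∈ p → j ∈ p → i ≢ j → f i ≢ f j) → (∀ {i} → i ∈ p → f i ∈ˡ xs) →
  ∣ p ∣ ≤ length xs
injectiveOn⇒∣p∣≤length _≟_ [] f xs inj into = z≤n
injectiveOn⇒∣p∣≤length _≟_ (outside ∷ p) f xs inj into =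
  injectiveOn⇒∣p∣≤length _≟_ p (f ∘ fsuc) xs (λ i∈ j∈ i≢j → inj (there i∈) (there j∈) (i≢j ∘ suc-injective)) (into ∘ there)
injectiveOn⇒∣p∣≤length _≟_ (inside ∷ p) f xs inj into = ≤-trans (s≤s ∣p∣≤∣xs-f0∣) ∣xs-f0∣<∣xs∣
  where
  ≢f0? : Decidable (_≢ f fzero)
  ≢f0? a = ¬? (a ≟ f fzero)
  ∣p∣≤∣xs-f0∣ : ∣ p ∣ ≤ length (filter ≢f0? xs)
  ∣p∣≤∣xs-f0∣ = injectiveOn⇒∣p∣≤length _≟_ p (f ∘ fsuc) (filter ≢f0? xs)
    (λ i∈ j∈ i≢j → inj (there i∈) (there j∈) (i≢j ∘ suc-injective))
    (λ i∈ → ∈-filter⁺ ≢f0? (into (there i∈)) (inj (there i∈) here λ ()))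
  ∣xs-f0∣<∣xs∣ : length (filter ≢f0? xs) < length xs
  ∣xs-f0∣<∣xs∣ = filter-notAll ≢f0? xs (Any.map (λ f0≡a a≢f0 → a≢f0 (≡-sym f0≡a)) (into here))

maximum-exists : ∀ {n ℓ} {Q : Pred (Subset n) ℓ} → Decidable Q → Q ⊥ →
  ∃ λ C → Q C × (∀ C′ → Q C′ → ∣ C′ ∣ ≤ ∣ C ∣)
maximum-exists {n} {Q = Q} Q? Q⊥ = go n (λ C _ → ∣p∣≤n C)
  where
  go : ∀ j → (∀ C → Q C → ∣ C ∣ ≤ j) → ∃ λ C → Q C × (∀ C′ → Q C′ → ∣ C′ ∣ ≤ ∣ C ∣)
  go zero bound = ⊥ , Q⊥ , λ C′ q → ≤-trans (bound C′ q) z≤n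
  go (suc j) bound with anySubset? (λ C → Q? C ×-dec (suc j ≤? ∣ C ∣))
  ... | yes (C , q , j<∣C∣) = C , q , λ C′ q′ → ≤-trans (bound C′ q′) j<∣C∣
  ... | no ∄C = go j (λ C′ q′ → ≤-pred (≰⇒> (λ j<∣C′∣ → ∄C (C′ , q′ , j<∣C′∣))))

module _ {n} (G : Graph n) where

  isCliqueAvoiding? : ∀ S → Decidable (IsCliqueAvoiding G S)
  isCliqueAvoiding? S C =
    all? (λ x → (x ∈? C) →-dec ¬? (x ∈? S)) ×-dec
    all? (λ x → all? (λ y → (x ∈? C) →-dec (y ∈? C) →-dec ¬? (x ≟f y) →-dec (adj G x y ≟b true)))

  omega-exists : ∀ S → ∃ (IsOmega G S)
  omega-exists S with maximum-exists (isCliqueAvoiding? S) ((λ x x∈ → contradiction x∈ ∉⊥) , λ x y x∈ → contradiction x∈ ∉⊥)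
  ... | C , clique , max = ∣ C ∣ , (C , clique , refl) , max

  omega-unique : ∀ {S m m′} → IsOmega G S m → IsOmega G S m′ → m ≡ m′
  omega-unique ((C , clique , refl) , max) ((C′ , clique′ , refl) , max′) =
    ≤-antisym (max′ C clique) (max C′ clique′)

  clique-size-bound : ∀ {c} → ProperColoring G c → ∀ {S C u v} → IsCliqueAvoiding G S C →
    u ∈ C → v ∈ C → ∣ C ∣ ≤ 2 + numCommonColors G c u v
  clique-size-bound {c} proper {S} {C} {u} {v} (_ , clique) u∈ v∈ =
    injectiveOn⇒∣p∣≤length _≟ℤ_ C c _ (λ x∈ y∈ x≢y → proper _ _ (clique _ _ x∈ y∈ x≢y)) colour∈
    where
    colour∈ : ∀ {x} → x ∈ C → c x ∈ˡ c u ∷ c v ∷ _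
    colour∈ {x} x∈ with x ≟f u | x ≟f v
    ... | yes refl | _ = hereˡ refl
    ... | no _ | yes refl = thereˡ (hereˡ refl)
    ... | no x≢u | no x≢v = thereˡ (thereˡ (∈-deduplicate⁺ _≟ℤ_ (∈-map⁺ c
      (∈-filter⁺ (λ w → commonNbr G u v w ≟b true) (∈-allFin x)
        (cong₂ _∧_ (clique u x u∈ x∈ (x≢u ∘ ≡-sym)) (clique v x v∈ x∈ (x≢v ∘ ≡-sym)))))))

samePair-sound : ∀ {n} (u v x y : Fin n) → samePair u v x y ≡ true → (x ≡ u × y ≡ v) ⊎ (x ≡ v × y ≡ u)
samePair-sound u v x y same =
  Sum.map (both (x ≟f u) (y ≟f v)) (both (x ≟f v) (y ≟f u)) (Equivalence.to T-∨ (Equivalence.from T-≡ same))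
  where
  both : ∀ {a b c d : Fin _} (a≟b : Dec (a ≡ b)) (c≟d : Dec (c ≡ d)) → T (does a≟b ∧ does c≟d) → a ≡ b × c ≡ d
  both (yes a≡b) (yes c≡d) _ = a≡b , c≡d
  both (yes _)   (no _)    ()
  both (no _)    _         ()

module _ {n} (G : Graph n) (u v : Fin n) {S : Subset n} where

  clique-deleteEdge⇒clique : ∀ {C} → IsCliqueAvoiding (deleteEdge G u v) S C → IsCliqueAvoiding G S C
  clique-deleteEdge⇒clique (avoids , clique) =
    avoids , λ x y x∈ y∈ x≢y → ∧-conicalˡ _ _ (clique x y x∈ y∈ x≢y)

  clique⇒clique-deleteEdge : ∀ {C} → IsCliqueAvoiding G S C → ¬ (u ∈ C × v ∈ C) →
    IsCliqueAvoiding (deleteEdge G u v) S C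
  clique⇒clique-deleteEdge {C} (avoids , clique) ¬both = avoids , λ x y x∈ y∈ x≢y →
    cong₂ _∧_ (clique x y x∈ y∈ x≢y) (≡-sym (¬-not (λ true≡same → ¬both (ends x∈ y∈ (samePair-sound u v x y (≡-sym true≡same))))))
    where
    ends : ∀ {x y} → x ∈ C → y ∈ C → (x ≡ u × y ≡ v) ⊎ (x ≡ v × y ≡ u) → u ∈ C × v ∈ C
    ends x∈ y∈ (inj₁ (refl , refl)) = x∈ , y∈
    ends x∈ y∈ (inj₂ (refl , refl)) = y∈ , x∈

  omega-deleteEdge : ∀ {m} → IsOmega G S m →
    (∀ {C} → IsCliqueAvoiding G S C → u ∈ C → v ∈ C → ∣ C ∣ < m) → IsOmega (deleteEdge G u v) S m
  omega-deleteEdge ((C , clique , refl) , max) small =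
    (C , clique⇒clique-deleteEdge clique (λ (u∈ , v∈) → <⇒≱ (small clique u∈ v∈) ≤-refl) , refl)
    , λ C′ clique′ → max C′ (clique-deleteEdge⇒clique clique′)

lemma7 : (n : ℕ) (G : Graph n) (k : ℕ) (lb : ℤ) (c : Fin n → ℤ) →
    ProperColoring G c →
    (θ : ℕ) → IsTheta G k θ →
    lb ≤ℤ + θ →
    (u v : Fin n) → Edge G u v →
    numCommonColors G c u v + 3 ≤ θ →
    IsTheta (deleteEdge G u v) k θ
lemma7 n G k lb c proper θ ((S₀ , ∣S₀∣≤k , ω₀) , θ-min) _ u v _ few-colours =
  (S₀ , ∣S₀∣≤k , omega-deleteEdge G u v ω₀ small) , θ-min′
  where
  small : ∀ {S C} → IsCliqueAvoiding G S C → u ∈ C → v ∈ C → ∣ C ∣ < θ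
  small clique u∈ v∈ = ≤-trans (s≤s (clique-size-bound G proper clique u∈ v∈))
                               (≤-trans (≤-reflexive (+-comm 3 _)) few-colours)
  θ-min′ : ∀ S m → ∣ S ∣ ≤ k → IsOmega (deleteEdge G u v) S m → θ ≤ m
  θ-min′ S m ∣S∣≤k ω′ with omega-exists G S
  ... | m₀ , ω = ≤-trans θ≤m₀ (≤-reflexive (omega-unique (deleteEdge G u v) ω″ ω′))
    where
    θ≤m₀ : θ ≤ m₀
    θ≤m₀ = θ-min S m₀ ∣S∣≤k ω
    ω″ : IsOmega (deleteEdge G u v) S m₀
    ω″ = omega-deleteEdge G u v ω (λ clique u∈ v∈ → ≤-trans (small clique u∈ v∈) θ≤m₀)
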